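{- Let $\mathfrak{T}_a\subseteq\mathfrak{D}'\subseteq\mathfrak{D}$, let $R\in\mathfrak{D}$, and let $\mathcal{E}(R)$ be the EV-system of $R$ with respect to $\mathfrak{D}'$. Then for all $\mathfrak{a},\mathfrak{b}\in\mathcal{E}_o(R)$: - $\mathfrak{a}\mathfrak{b}\in A(\mathcal{E}(R)^*)$ if and only if $\mathfrak{a}_1\in\mathfrak{b}_2$ and $\mathfrak{b}_1\in\mathfrak{a}_3$; - $\mathfrak{a}\mathfrak{a}\in A(\mathcal{E}(R))$ if and only if $\mathfrak{a}_1\mathfrak{a}_1\in A(R)$. Moreover, ERD and AID hold if $\mathfrak{D}'=\mathfrak{D}$, and they also hold if $R\in\mathfrak{T}_a$.
   Context: Digraphs $G=(V(G),A(G))$ have a finite nonempty vertex set, and $A(G)\subseteq V(G)\times V(G)$; loops are allowed. $G^*$ is $G$ with all loops removed. $N^{in}_G(v)$ is the set of $w\ne v$ with $wv\in A(G)$, and $N^{out}_G(v)$ the set of $w\neq v$ with $vw\in A(G)$. A homomorphism maps arcs to arcs; it is strict if, in addition, it maps proper arcs ($v\neq w$) to proper arcs. $\mathcal{S}(G,H)$ is the set of strict homomorphisms. Classes of digraphs: $\mathfrak{D}$ is a representative system of the isomorphism classes of finite digraphs (constructed digraphs are identified with their representatives). $\mathfrak{T}_a=\{G\in\mathfrak{D}: G^*\text{ contains no closed walk}\}$. EV-system of $R$ with respect to $\mathfrak{D}'$: - Vertex set $\mathcal{E}_o(R)=\{(v,D,U):v\in V(R),\ D\subseteq N^{in}_R(v),\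 U\subseteq N^{out}_R(v)\}$, with components $\mathfrak{a}_1,\mathfrak{a}_2,\mathfrak{a}_3$. - $\phi_R(\mathfrak{a})=\mathfrak{a}_1$. - For $G\in\mathfrak{D}'$ and $\xi\in\mathcal{S}(G,R)$, $\alpha^R_{G,\xi}(v)=(\xi(v),\xi[N^{in}_G(v)],\xi[N^{out}_G(v)])$. - $\mathfrak{a}\mathfrak{b}\in A(\mathcal{E}(R))$ iff there exist $G\in\mathfrak{D}'$, $\xi\in\mathcal{S}(G,R)$ and $vw\in A(G)$ with $\mathfrak{a}=\alpha^R_{G,\xi}(v)$ and $\mathfrak{b}=\alpha^R_{G,\xi}(w)$. ERD means $\mathcal{E}(R)\in\mathfrak{D}'$. AID means that ERD holds and $\alpha^R_{\mathcal{E}(R),\phi_R}$ is the identity of $\mathcal{E}_o(R)$. -}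

module Defs where

open import Data.Nat using (ℕ; suc)
open import Data.Fin using (Fin; _≟_)
open import Data.Fin.Subset using (Subset; _∈_)
open import Data.Fin.Subset.Properties using (_∈?_; _⊆?_)
open import Data.Fin.Properties using (any?)
open import Data.Bool using (Bool; true; not; _∧_)
open import Data.Vec using (tabulate)
open import Data.Product using (Σ; Σ-syntax; ∃; ∃-syntax; _×_; _,_; proj₁; proj₂)
open import Relation.Nullary using (¬_)
open import Relation.Nullary.Decidable using (⌊_⌋; True; _×-dec_)
open import Relation.Binary.PropositionalEquality using (_≡_; _≢_)
open import Function.Bundles using (_↔_; _⇔_; Inverse)

-- Finite digraphs (loops allowed) on the nonempty vertex set Fin (suc n),
-- with the (finite, hence decidable) arc set given by a Bool-valued relation.

record Digraph : Set where
  constructor mkDigraph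
  field
    n   : ℕ
    arc : Fin (suc n) → Fin (suc n) → Bool

open Digraph public

V : Digraph → Set
V G = Fin (suc (n G))

Arc : (G : Digraph) → V G → V G → Set
Arc G v w = arc G v w ≡ true

-- vw ∈ A(G*) (proper arc)
ProperArc : (G : Digraph) → V G → V G → Set
ProperArc G v w = v ≢ w × Arc G v w

Nin : (G : Digraph) → V G → Subset (suc (n G))
Nin G v = tabulate (λ w → not ⌊ w ≟ v ⌋ ∧ arc G w v)

Nout : (G : Digraph) → V G → Subset (suc (n G))
Nout G v = tabulate (λ w → not ⌊ w ≟ v ⌋ ∧ arc G v w)

image : ∀ {k m} → (Fin k → Fin m) → Subset k → Subset m
image ξ S = tabulate (λ x → ⌊ any? (λ w → (w ∈? S) ×-dec (ξ w ≟ x)) ⌋)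

IsStrictHom : (G H : Digraph) → (V G → V H) → Set
IsStrictHom G H ξ =
  (∀ v w → Arc G v w → Arc H (ξ v) (ξ w)) ×
  (∀ v w → ProperArc G v w → ξ v ≢ ξ w)

Iso : Digraph → Digraph → Set
Iso G H = Σ[ f ∈ (V G ↔ V H) ] (∀ v w → arc G v w ≡ arc H (Inverse.to f v) (Inverse.to f w))

-- A class of digraphs 𝔇' ⊆ 𝔇: since 𝔇 is a representative system of the
-- isomorphism classes, a class is a predicate on digraphs invariant under isomorphism.
IsoInvariant : (Digraph → Set) → Set
IsoInvariant P = ∀ G H → Iso G H → P G → P H

data Walk⁺ (G : Digraph) : V G → V G → Set where
  step : ∀ {v w} → ProperArc G v w → Walk⁺ G v w
  _∷_  : ∀ {u v w} → ProperArc G u v → Walk⁺ G v w → Walk⁺ G u w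

InTa : Digraph → Set
InTa G = ∀ v → ¬ Walk⁺ G v v

Triple : Digraph → Set
Triple R = V R × Subset (suc (n R)) × Subset (suc (n R))

EV : Digraph → Set
EV R = Σ[ t ∈ Triple R ]
         True (proj₁ (proj₂ t) ⊆? Nin R (proj₁ t)) ×
         True (proj₂ (proj₂ t) ⊆? Nout R (proj₁ t))

triple : (R : Digraph) → EV R → Triple R
triple R = proj₁

𝔞₁ : (R : Digraph) → EV R → V R
𝔞₁ R a = proj₁ (triple R a)

𝔞₂ : (R : Digraph) → EV R → Subset (suc (n R))
𝔞₂ R a = proj₁ (proj₂ (triple R a))

𝔞₃ : (R : Digraph) → EV R → Subset (suc (n R))
𝔞₃ R a = proj₂ (proj₂ (triple R a))

φ : (R : Digraph) → EV R → V R
φ = 𝔞₁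

α : (R G : Digraph) → (V G → V R) → V G → Triple R
α R G ξ v = ξ v , image ξ (Nin G v) , image ξ (Nout G v)

EArc : (𝔇' : Digraph → Set) (R : Digraph) → EV R → EV R → Set
EArc 𝔇' R a b =
  ∃[ G ] 𝔇' G × (Σ[ ξ ∈ (V G → V R) ] IsStrictHom G R ξ ×
    (∃[ v ] ∃[ w ] Arc G v w × α R G ξ v ≡ triple R a × α R G ξ w ≡ triple R b))

EArc* : (𝔇' : Digraph → Set) (R : Digraph) → EV R → EV R → Set
EArc* 𝔇' R a b = a ≢ b × EArc 𝔇' R a b

-- ℰ(R) is isomorphic to the digraph H (H is a copy of ℰ(R) on Fin-vertices)
IsEV : (𝔇' : Digraph → Set) (R H : Digraph) → (EV R ↔ V H) → Set
IsEV 𝔇' R H β = ∀ a b → Arc H (Inverse.to β a) (Inverse.to β b) ⇔ EArc 𝔇' R a b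

ERD : (𝔇' : Digraph → Set) → Digraph → Set
ERD 𝔇' R = ∃[ H ] 𝔇' H × Σ[ β ∈ (EV R ↔ V H) ] IsEV 𝔇' R H β

-- AID: ERD holds and α^R_{ℰ(R),φ_R} is the identity of ℰ_o(R)
-- (with φ_R a strict homomorphism ℰ(R) → R, so that α is defined)
AID : (𝔇' : Digraph → Set) → Digraph → Set
AID 𝔇' R = ∃[ H ] 𝔇' H × Σ[ β ∈ (EV R ↔ V H) ] IsEV 𝔇' R H β ×
  (let ξ : V H → V R
       ξ x = φ R (Inverse.from β x)
   in IsStrictHom H R ξ × (∀ a → α R H ξ (Inverse.to β a) ≡ triple R a))

module Submission where

-- Every vertex 𝔞 of ℰ(R) is realised in an acyclic star: a hub sent to 𝔞₁, with
-- in-leaves sent onto 𝔞₂ and out-leaves sent onto 𝔞₃. An arc from the hub of 𝔞 to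
-- the hub of 𝔟 keeps all four neighbourhood images unchanged exactly when 𝔞₁ ∈ 𝔟₂ and
-- 𝔟₁ ∈ 𝔞₃, and a loop at the hub is a homomorphic image exactly when 𝔞₁𝔞₁ ∈ A(R);
-- conversely every realised arc forces these conditions. So the arcs of ℰ(R) are
-- decidable and ℰ(R) is a finite digraph. The vertex (x, ∅, {𝔞₁}) is linked to 𝔞 for
-- every x ∈ 𝔞₂, hence φ maps the in-neighbourhood of 𝔞 in ℰ(R) onto 𝔞₂ (dually 𝔞₃),
-- which is AID. Since φ is a strict homomorphism, R ∈ 𝔗ₐ forces ℰ(R) ∈ 𝔗ₐ ⊆ 𝔇'.

open import Defs
open import Data.Fin.Subset using (_∈_)
open import Data.Product using (_×_)
open import Function.Bundles using (_⇔_)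

open import Data.Bool using (Bool; true; false; not; _∧_; T?)
import Data.Bool.Properties as Bool
open import Data.Empty using (⊥-elim)
open import Data.Fin using (Fin; zero; suc; _≟_; join; splitAt)
open import Data.Fin.Properties using (any?; join-splitAt; splitAt-join)
open import Data.Fin.Subset using (Subset; _⊆_; ⁅_⁆; inside; outside) renaming (⊥ to ∅)
open import Data.Fin.Subset.Properties using (_∈?_; _⊆?_; ⊆-antisym; ⊥⊆; x∈⁅x⁆; x∈⁅y⁆⇒x≡y)
open import Data.List using (List; []; _∷_; [_]; map; _++_; length; lookup; allFin; cartesianProduct; deduplicate)
open import Data.List.Membership.Propositional using () renaming (_∈_ to _∈ₗ_)
open import Data.List.Membership.Propositional.Properties
  using (∈-map⁺; ∈-++⁺ˡ; ∈-++⁺ʳ; ∈-allFin; ∈-cartesianProduct⁺; ∈-deduplicate⁺; ∈-lookup)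
open import Data.List.Membership.Propositional.Properties.WithK using (unique⇒irrelevant)
open import Data.List.Relation.Unary.Any using (here; there; index)
open import Data.List.Relation.Unary.Any.Properties using (lookup-index)
open import Data.List.Relation.Unary.Unique.Propositional using (Unique)
import Data.List.Relation.Unary.Unique.DecPropositional.Properties as Unique
open import Data.Nat using (ℕ; zero; suc; _+_; _<_; z≤n; s≤s)
open import Data.Nat.Properties using (<-trans; <-irrefl)
open import Data.Product using (Σ; ∃-syntax; _,_; proj₁; proj₂)
import Data.Product.Properties as Product
open import Data.Sum using (_⊎_; inj₁; inj₂)
open import Data.Vec as Vec using (tabulate)
open import Data.Vec.Properties using (lookup∘tabulate; []=⇒lookup; lookup⇒[]=) renaming (≡-dec to ≡-dec-Vec)
open import Function using (_∘_; flip)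
open import Function.Bundles using (_↔_; Inverse; mk↔ₛ′; mk⇔)
open import Relation.Binary.Definitions using (DecidableEquality)
open import Relation.Binary.PropositionalEquality
  using (_≡_; _≢_; refl; sym; trans; cong; cong₂; subst; subst₂; module ≡-Reasoning)
open import Relation.Nullary using (¬_; Dec; yes; no; Irrelevant)
open import Relation.Nullary.Decidable using (⌊_⌋; True; map′; _×-dec_; dec-true; isYes≗does; fromWitness; toWitness)
open import Relation.Unary using (Decidable)

⌊⌋≡true⁺ : ∀ {P : Set} (P? : Dec P) → P → ⌊ P? ⌋ ≡ true
⌊⌋≡true⁺ P? p = trans (isYes≗does P?) (dec-true P? p)

⌊⌋≡true⁻ : ∀ {P : Set} (P? : Dec P) → ⌊ P? ⌋ ≡ true → P
⌊⌋≡true⁻ (yes p) _ = p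

¬∧≡true⁺ : ∀ {P : Set} (P? : Dec P) {b} → ¬ P → b ≡ true → not ⌊ P? ⌋ ∧ b ≡ true
¬∧≡true⁺ (yes p) ¬p _ = ⊥-elim (¬p p)
¬∧≡true⁺ (no _)  _  e = e

¬∧≡true⁻ : ∀ {P : Set} (P? : Dec P) {b} → not ⌊ P? ⌋ ∧ b ≡ true → ¬ P × b ≡ true
¬∧≡true⁻ (no ¬p) e = ¬p , e

∈-tabulate⁺ : ∀ {m} (f : Fin m → Bool) {x} → f x ≡ true → x ∈ tabulate f
∈-tabulate⁺ f {x} e = lookup⇒[]= x _ (trans (lookup∘tabulate f x) e)

∈-tabulate⁻ : ∀ {m} (f : Fin m → Bool) {x} → x ∈ tabulate f → f x ≡ true
∈-tabulate⁻ f {x} h = trans (sym (lookup∘tabulate f x)) ([]=⇒lookup h)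

x∈p⇒⁅x⁆⊆p : ∀ {m} {x : Fin m} {p : Subset m} → x ∈ p → ⁅ x ⁆ ⊆ p
x∈p⇒⁅x⁆⊆p {p = p} x∈p y∈⁅x⁆ = subst (_∈ p) (sym (x∈⁅y⁆⇒x≡y _ y∈⁅x⁆)) x∈p

module _ (G : Digraph) {v w : V G} where

  private
    into-v from-v : V G → Bool
    into-v u = not ⌊ u ≟ v ⌋ ∧ arc G u v
    from-v u = not ⌊ u ≟ v ⌋ ∧ arc G v u

  ∈-Nin⁺ : ProperArc G w v → w ∈ Nin G v
  ∈-Nin⁺ (w≢v , e) = ∈-tabulate⁺ into-v (¬∧≡true⁺ (w ≟ v) w≢v e)

  ∈-Nin⁻ : w ∈ Nin G v → ProperArc G w v
  ∈-Nin⁻ h = ¬∧≡true⁻ (w ≟ v) (∈-tabulate⁻ into-v h)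

  ∈-Nout⁺ : ProperArc G v w → w ∈ Nout G v
  ∈-Nout⁺ (v≢w , e) = ∈-tabulate⁺ from-v (¬∧≡true⁺ (w ≟ v) (v≢w ∘ sym) e)

  ∈-Nout⁻ : w ∈ Nout G v → ProperArc G v w
  ∈-Nout⁻ h with w≢v , e ← ¬∧≡true⁻ (w ≟ v) (∈-tabulate⁻ from-v h) = w≢v ∘ sym , e

module _ {k m} (ξ : Fin k → Fin m) where

  private
    hits : Subset k → Fin m → Bool
    hits S x = ⌊ any? (λ u → (u ∈? S) ×-dec (ξ u ≟ x)) ⌋

  ∈-image⁺ : ∀ {S w} → w ∈ S → ξ w ∈ image ξ S
  ∈-image⁺ {S} {w} h = ∈-tabulate⁺ (hits S) (⌊⌋≡true⁺ (any? _) (w , h , refl))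

  ∈-image⁻ : ∀ {S x} → x ∈ image ξ S → ∃[ w ] w ∈ S × ξ w ≡ x
  ∈-image⁻ {S} h = ⌊⌋≡true⁻ (any? _) (∈-tabulate⁻ (hits S) h)

  image-≡ : ∀ {T S} → (∀ {w} → w ∈ T → ξ w ∈ S) → (∀ {x} → x ∈ S → ∃[ w ] w ∈ T × ξ w ≡ x) →
            image ξ T ≡ S
  image-≡ {T} {S} into onto = ⊆-antisym
    (λ h → let w , w∈T , ξw≡x = ∈-image⁻ h in subst (_∈ S) ξw≡x (into w∈T))
    (λ h → let w , w∈T , ξw≡x = onto h in subst (_∈ image ξ T) ξw≡x (∈-image⁺ w∈T))

-- Strict homomorphisms and the class 𝔗ₐ

Walk⁺-rank< : (G : Digraph) (ρ : V G → ℕ) → (∀ {v w} → ProperArc G v w → ρ v < ρ w) →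
              ∀ {v w} → Walk⁺ G v w → ρ v < ρ w
Walk⁺-rank< G ρ incr (step e) = incr e
Walk⁺-rank< G ρ incr (e ∷ es) = <-trans (incr e) (Walk⁺-rank< G ρ incr es)

rank⇒InTa : (G : Digraph) (ρ : V G → ℕ) → (∀ {v w} → ProperArc G v w → ρ v < ρ w) → InTa G
rank⇒InTa G ρ incr v walk = <-irrefl refl (Walk⁺-rank< G ρ incr walk)

module _ (G K : Digraph) (ξ : V G → V K) (ξ-strict : IsStrictHom G K ξ) where

  strictHom-properArc : ∀ {v w} → ProperArc G v w → ProperArc K (ξ v) (ξ w)
  strictHom-properArc e = proj₂ ξ-strict _ _ e , proj₁ ξ-strict _ _ (proj₂ e)

  map-Walk⁺ : ∀ {v w} → Walk⁺ G v w → Walk⁺ K (ξ v) (ξ w)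
  map-Walk⁺ (step e) = step (strictHom-properArc e)
  map-Walk⁺ (e ∷ es) = strictHom-properArc e ∷ map-Walk⁺ es

  strictHom-reflects-InTa : InTa K → InTa G
  strictHom-reflects-InTa K-Ta v walk = K-Ta (ξ v) (map-Walk⁺ walk)

module _ {A : Set} where

  index-∈-lookup : (xs : List A) (i : Fin (length xs)) → index (∈-lookup {xs = xs} i) ≡ i
  index-∈-lookup (_ ∷ _)  zero    = refl
  index-∈-lookup (_ ∷ xs) (suc i) = cong suc (index-∈-lookup xs i)

  unique-enumeration⇒↔Fin : (xs : List A) → Unique xs → (∀ a → a ∈ₗ xs) → A ↔ Fin (length xs)
  unique-enumeration⇒↔Fin xs xs! complete =
    mk↔ₛ′ (index ∘ complete) (lookup xs) index∘lookup (sym ∘ lookup-index ∘ complete)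
    where
    index∘lookup : ∀ i → index (complete (lookup xs i)) ≡ i
    index∘lookup i = begin
      index (complete (lookup xs i)) ≡⟨ cong index (unique⇒irrelevant xs! _ (∈-lookup i)) ⟩
      index (∈-lookup {xs = xs} i)   ≡⟨ index-∈-lookup xs i ⟩
      i                              ∎
      where open ≡-Reasoning

  enumeration⇒↔Fin : (_≟A_ : DecidableEquality A) (xs : List A) → (∀ a → a ∈ₗ xs) →
                     A ↔ Fin (length (deduplicate _≟A_ xs))
  enumeration⇒↔Fin _≟A_ xs complete = unique-enumeration⇒↔Fin (deduplicate _≟A_ xs)
    (Unique.deduplicate-! _≟A_ xs) (∈-deduplicate⁺ _≟A_ ∘ complete)

  inhabited-↔Fin : ∀ {m} → A → A ↔ Fin m → ∃[ k ] A ↔ Fin (suc k)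
  inhabited-↔Fin {zero}  a β with () ← Inverse.to β a
  inhabited-↔Fin {suc k} _ β = k , β

module _ {A : Set} {P : A → Set} (P? : Decidable P) (P-irrelevant : ∀ {x} → Irrelevant (P x)) where

  withWitnesses : List A → List (Σ A P)
  withWitnesses []       = []
  withWitnesses (x ∷ xs) with P? x
  ... | yes p = (x , p) ∷ withWitnesses xs
  ... | no _  = withWitnesses xs

  ∈-withWitnesses : ∀ {x xs} (p : P x) → x ∈ₗ xs → (x , p) ∈ₗ withWitnesses xs
  ∈-withWitnesses {x} p (here refl) with P? x
  ... | yes q = here (cong (x ,_) (P-irrelevant p q))
  ... | no ¬p = ⊥-elim (¬p p)
  ∈-withWitnesses {xs = y ∷ _} p (there h) with P? y
  ... | yes _ = there (∈-withWitnesses p h)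
  ... | no _  = ∈-withWitnesses p h

allSubsets : ∀ m → List (Subset m)
allSubsets zero    = [ Vec.[] ]
allSubsets (suc m) = map (inside Vec.∷_) (allSubsets m) ++ map (outside Vec.∷_) (allSubsets m)

∈-allSubsets : ∀ {m} (S : Subset m) → S ∈ₗ allSubsets m
∈-allSubsets Vec.[]            = here refl
∈-allSubsets (inside Vec.∷ S)  = ∈-++⁺ˡ (∈-map⁺ (inside Vec.∷_) (∈-allSubsets S))
∈-allSubsets (outside Vec.∷ S) = ∈-++⁺ʳ _ (∈-map⁺ (outside Vec.∷_) (∈-allSubsets S))

module _ {A : Set} {k : ℕ} (β : A ↔ Fin (suc k)) (r : A → A → Bool) where

  open Inverse β using (to; from; strictlyInverseˡ; strictlyInverseʳ)

  onFinite : Digraph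
  onFinite = mkDigraph k (λ i j → r (from i) (from j))

  arc-onFinite : ∀ p q → arc onFinite (to p) (to q) ≡ r p q
  arc-onFinite p q = cong₂ r (strictlyInverseʳ p) (strictlyInverseʳ q)

  private
    to-injective : ∀ {p q} → to p ≡ to q → p ≡ q
    to-injective {p} {q} e = trans (sym (strictlyInverseʳ p)) (trans (cong from e) (strictlyInverseʳ q))

    from-injective : ∀ {i j} → from i ≡ from j → i ≡ j
    from-injective {i} {j} e = trans (sym (strictlyInverseˡ i)) (trans (cong to e) (strictlyInverseˡ j))

  onFinite-isStrictHom : (K : Digraph) (ψ : A → V K) →
    (∀ p q → r p q ≡ true → Arc K (ψ p) (ψ q)) →
    (∀ p q → p ≢ q → r p q ≡ true → ψ p ≢ ψ q) →
    IsStrictHom onFinite K (ψ ∘ from)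
  onFinite-isStrictHom K ψ hom strict =
    (λ i j → hom (from i) (from j)) , (λ i j (i≢j , e) → strict _ _ (i≢j ∘ from-injective) e)

  rank⇒InTa-onFinite : (ρ : A → ℕ) → (∀ p q → p ≢ q → r p q ≡ true → ρ p < ρ q) → InTa onFinite
  rank⇒InTa-onFinite ρ incr =
    rank⇒InTa onFinite (ρ ∘ from) (λ (i≢j , e) → incr _ _ (i≢j ∘ from-injective) e)

  image-Nin-onFinite : ∀ {m} (ψ : A → Fin m) (p : A) {S : Subset m} →
    (∀ q → q ≢ p → r q p ≡ true → ψ q ∈ S) →
    (∀ {x} → x ∈ S → ∃[ q ] q ≢ p × r q p ≡ true × ψ q ≡ x) →
    image (ψ ∘ from) (Nin onFinite (to p)) ≡ S
  image-Nin-onFinite ψ p {S} into onto = image-≡ (ψ ∘ from) into′ onto′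
    where
    into′ : ∀ {i} → i ∈ Nin onFinite (to p) → ψ (from i) ∈ S
    into′ {i} h with i≢p , e ← ∈-Nin⁻ onFinite h =
      into (from i) (λ fi≡p → i≢p (trans (sym (strictlyInverseˡ i)) (cong to fi≡p)))
           (subst (λ s → r (from i) s ≡ true) (strictlyInverseʳ p) e)
    onto′ : ∀ {x} → x ∈ S → ∃[ i ] i ∈ Nin onFinite (to p) × ψ (from i) ≡ x
    onto′ h with q , q≢p , e , ψq≡x ← onto h =
      to q , ∈-Nin⁺ onFinite (q≢p ∘ to-injective , trans (arc-onFinite q p) e) ,
      trans (cong ψ (strictlyInverseʳ q)) ψq≡x

-- Nout of a digraph is, definitionally, Nin of its transpose.
image-Nout-onFinite : ∀ {A : Set} {k} (β : A ↔ Fin (suc k)) (r : A → A → Bool) →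
  ∀ {m} (ψ : A → Fin m) (p : A) {S : Subset m} →
  (∀ q → q ≢ p → r p q ≡ true → ψ q ∈ S) →
  (∀ {x} → x ∈ S → ∃[ q ] q ≢ p × r p q ≡ true × ψ q ≡ x) →
  image (ψ ∘ Inverse.from β) (Nout (onFinite β r) (Inverse.to β p)) ≡ S
image-Nout-onFinite β r = image-Nin-onFinite β (flip r)

module EVVertex (R : Digraph) where

  Linked : EV R → EV R → Set
  Linked a b = 𝔞₁ R a ∈ 𝔞₂ R b × 𝔞₁ R b ∈ 𝔞₃ R a

  Linked? : ∀ a b → Dec (Linked a b)
  Linked? a b = (𝔞₁ R a ∈? 𝔞₂ R b) ×-dec (𝔞₁ R b ∈? 𝔞₃ R a)

  𝔞₂⊆Nin : (a : EV R) → 𝔞₂ R a ⊆ Nin R (𝔞₁ R a)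
  𝔞₂⊆Nin a = toWitness (proj₁ (proj₂ a))

  𝔞₃⊆Nout : (a : EV R) → 𝔞₃ R a ⊆ Nout R (𝔞₁ R a)
  𝔞₃⊆Nout a = toWitness (proj₂ (proj₂ a))

  Linked⇒𝔞₁≢ : ∀ a b → Linked a b → 𝔞₁ R a ≢ 𝔞₁ R b
  Linked⇒𝔞₁≢ _ b (a₁∈b₂ , _) = proj₁ (∈-Nin⁻ R (𝔞₂⊆Nin b a₁∈b₂))

  triple-injective : ∀ {a b : EV R} → triple R a ≡ triple R b → a ≡ b
  triple-injective {_ , p , q} {_ , p′ , q′} refl =
    cong₂ (λ p q → _ , p , q) (Bool.T-irrelevant p p′) (Bool.T-irrelevant q q′)

  _≟EV_ : DecidableEquality (EV R)
  a ≟EV b = map′ triple-injective (cong (triple R))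
    (Product.≡-dec _≟_ (Product.≡-dec ≟Subset ≟Subset) (triple R a) (triple R b))
    where ≟Subset = ≡-dec-Vec Bool._≟_

  inNeighbour : ∀ a x → x ∈ 𝔞₂ R a → EV R
  inNeighbour a x x∈ = (x , ∅ , ⁅ 𝔞₁ R a ⁆) , fromWitness (λ {y} → ⊥⊆) ,
    fromWitness (λ {y} → x∈p⇒⁅x⁆⊆p (∈-Nout⁺ R (∈-Nin⁻ R (𝔞₂⊆Nin a x∈))))

  outNeighbour : ∀ a y → y ∈ 𝔞₃ R a → EV R
  outNeighbour a y y∈ = (y , ⁅ 𝔞₁ R a ⁆ , ∅) ,
    fromWitness (λ {x} → x∈p⇒⁅x⁆⊆p (∈-Nin⁺ R (∈-Nout⁻ R (𝔞₃⊆Nout a y∈)))) , fromWitness (λ {x} → ⊥⊆)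

  -- Opaque, since unfolding the enumeration makes conversion checks involving ℰ(R) very slow.
  opaque
    EV↔Fin : ∃[ k ] EV R ↔ Fin (suc k)
    EV↔Fin = inhabited-↔Fin (isolated zero) (enumeration⇒↔Fin _≟EV_ vertices
      λ a → ∈-withWitnesses Valid? Valid-irrelevant (proj₂ a) (∈-triples (triple R a)))
      where
      N : ℕ
      N = suc (n R)
      triples : List (Triple R)
      triples = cartesianProduct (allFin N) (cartesianProduct (allSubsets N) (allSubsets N))
      ∈-triples : ∀ t → t ∈ₗ triples
      ∈-triples (v , D , U) =
        ∈-cartesianProduct⁺ (∈-allFin v) (∈-cartesianProduct⁺ (∈-allSubsets D) (∈-allSubsets U))
      Valid : Triple R → Set
      Valid (v , D , U) = True (D ⊆? Nin R v) × True (U ⊆? Nout R v)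
      Valid? : Decidable Valid
      Valid? (v , D , U) = T? _ ×-dec T? _
      Valid-irrelevant : ∀ {t} → Irrelevant (Valid t)
      Valid-irrelevant (p , q) (p′ , q′) = cong₂ _,_ (Bool.T-irrelevant p p′) (Bool.T-irrelevant q q′)
      vertices : List (EV R)
      vertices = withWitnesses Valid? Valid-irrelevant triples
      isolated : V R → EV R
      isolated v = (v , ∅ , ∅) , fromWitness (λ {x} → ⊥⊆) , fromWitness (λ {x} → ⊥⊆)

-- Acyclic digraphs realising two vertices of ℰ(R)

data Node (m : ℕ) : Set where
  hubA hubB : Node m
  leaf      : Fin m ⊎ Fin m → Node m

pattern inLeaf x  = leaf (inj₁ x)
pattern outLeaf y = leaf (inj₂ y)

Node↔Fin : ∀ m → Node m ↔ Fin (suc (suc (m + m)))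
Node↔Fin m = mk↔ₛ′ encode decode encode∘decode decode∘encode
  where
  encode : Node m → Fin (suc (suc (m + m)))
  encode hubA     = zero
  encode hubB     = suc zero
  encode (leaf s) = suc (suc (join m m s))

  decode : Fin (suc (suc (m + m))) → Node m
  decode zero          = hubA
  decode (suc zero)    = hubB
  decode (suc (suc i)) = leaf (splitAt m i)

  encode∘decode : ∀ i → encode (decode i) ≡ i
  encode∘decode zero          = refl
  encode∘decode (suc zero)    = refl
  encode∘decode (suc (suc i)) = cong (λ j → suc (suc j)) (join-splitAt m m i)

  decode∘encode : ∀ p → decode (encode p) ≡ p
  decode∘encode hubA     = refl
  decode∘encode hubB     = refl
  decode∘encode (leaf s) = cong leaf (splitAt-join m m s)

module Gadget (R : Digraph) (a b : EV R) (loop link : Bool) where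

  open EVVertex R

  Vertex : Set
  Vertex = Node (suc (n R))

  gadgetArc : Vertex → Vertex → Bool
  gadgetArc hubA       hubA        = loop
  gadgetArc hubA       hubB        = link
  gadgetArc hubA       (outLeaf y) = ⌊ y ∈? 𝔞₃ R a ⌋
  gadgetArc hubB       (outLeaf y) = ⌊ y ∈? 𝔞₃ R b ⌋
  gadgetArc (inLeaf x) hubA        = ⌊ x ∈? 𝔞₂ R a ⌋
  gadgetArc (inLeaf x) hubB        = ⌊ x ∈? 𝔞₂ R b ⌋
  gadgetArc _          _           = false

  data GadgetArc : Vertex → Vertex → Set where
    loopArc : loop ≡ true → GadgetArc hubA hubA
    linkArc : link ≡ true → GadgetArc hubA hubB
    outArcA : ∀ {y} → y ∈ 𝔞₃ R a → GadgetArc hubA (outLeaf y)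
    outArcB : ∀ {y} → y ∈ 𝔞₃ R b → GadgetArc hubB (outLeaf y)
    inArcA  : ∀ {x} → x ∈ 𝔞₂ R a → GadgetArc (inLeaf x) hubA
    inArcB  : ∀ {x} → x ∈ 𝔞₂ R b → GadgetArc (inLeaf x) hubB

  gadgetArc-view : ∀ p q → gadgetArc p q ≡ true → GadgetArc p q
  gadgetArc-view hubA        hubA        e = loopArc e
  gadgetArc-view hubA        hubB        e = linkArc e
  gadgetArc-view hubA        (outLeaf y) e = outArcA (⌊⌋≡true⁻ (y ∈? _) e)
  gadgetArc-view hubB        (outLeaf y) e = outArcB (⌊⌋≡true⁻ (y ∈? _) e)
  gadgetArc-view (inLeaf x)  hubA        e = inArcA (⌊⌋≡true⁻ (x ∈? _) e)
  gadgetArc-view (inLeaf x)  hubB        e = inArcB (⌊⌋≡true⁻ (x ∈? _) e)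
  gadgetArc-view hubA        (inLeaf _)  ()
  gadgetArc-view hubB        hubA        ()
  gadgetArc-view hubB        hubB        ()
  gadgetArc-view hubB        (inLeaf _)  ()
  gadgetArc-view (inLeaf _)  (leaf _)    ()
  gadgetArc-view (outLeaf _) _           ()

  label : Vertex → V R
  label hubA        = 𝔞₁ R a
  label hubB        = 𝔞₁ R b
  label (inLeaf x)  = x
  label (outLeaf y) = y

  rank : Vertex → ℕ
  rank (inLeaf _)  = 0
  rank hubA        = 1
  rank hubB        = 2
  rank (outLeaf _) = 3

  rank-< : ∀ {p q} → GadgetArc p q → p ≢ q → rank p < rank q
  rank-< (loopArc _) p≢q = ⊥-elim (p≢q refl)
  rank-< (linkArc _) _   = s≤s (s≤s z≤n)
  rank-< (outArcA _) _   = s≤s (s≤s z≤n)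
  rank-< (outArcB _) _   = s≤s (s≤s (s≤s z≤n))
  rank-< (inArcA _)  _   = s≤s z≤n
  rank-< (inArcB _)  _   = s≤s z≤n

  β : Vertex ↔ Fin (suc (suc (suc (n R) + suc (n R))))
  β = Node↔Fin (suc (n R))

  open Inverse β using (to; from)

  G : Digraph
  G = onFinite β gadgetArc

  ξ : V G → V R
  ξ = label ∘ from

  G-InTa : InTa G
  G-InTa = rank⇒InTa-onFinite β gadgetArc rank (λ p q p≢q e → rank-< (gadgetArc-view p q e) p≢q)

  module Realisation (loop⇒ : loop ≡ true → Arc R (𝔞₁ R a) (𝔞₁ R a))
                     (link⇒ : link ≡ true → Linked a b) where

    label-properArc : ∀ {p q} → GadgetArc p q → p ≢ q → ProperArc R (label p) (label q)
    label-properArc (loopArc _)  p≢q = ⊥-elim (p≢q refl)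
    label-properArc (linkArc e)  _   = ∈-Nin⁻ R (𝔞₂⊆Nin b (proj₁ (link⇒ e)))
    label-properArc (outArcA y∈) _   = ∈-Nout⁻ R (𝔞₃⊆Nout a y∈)
    label-properArc (outArcB y∈) _   = ∈-Nout⁻ R (𝔞₃⊆Nout b y∈)
    label-properArc (inArcA x∈)  _   = ∈-Nin⁻ R (𝔞₂⊆Nin a x∈)
    label-properArc (inArcB x∈)  _   = ∈-Nin⁻ R (𝔞₂⊆Nin b x∈)

    label-arc : ∀ {p q} → GadgetArc p q → Arc R (label p) (label q)
    label-arc (loopArc e)   = loop⇒ e
    label-arc g@(linkArc _) = proj₂ (label-properArc g λ ())
    label-arc g@(outArcA _) = proj₂ (label-properArc g λ ())
    label-arc g@(outArcB _) = proj₂ (label-properArc g λ ())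
    label-arc g@(inArcA _)  = proj₂ (label-properArc g λ ())
    label-arc g@(inArcB _)  = proj₂ (label-properArc g λ ())

    ξ-isStrictHom : IsStrictHom G R ξ
    ξ-isStrictHom = onFinite-isStrictHom β gadgetArc R label
      (λ p q e → label-arc (gadgetArc-view p q e))
      (λ p q p≢q e → proj₁ (label-properArc (gadgetArc-view p q e) p≢q))

    α-hubA : α R G ξ (to hubA) ≡ triple R a
    α-hubA = cong₂ (λ D U → 𝔞₁ R a , D , U)
      (image-Nin-onFinite β gadgetArc label hubA
        (λ q q≢A e → into (gadgetArc-view q hubA e) q≢A)
        (λ x∈ → inLeaf _ , (λ ()) , ⌊⌋≡true⁺ (_ ∈? _) x∈ , refl))
      (image-Nout-onFinite β gadgetArc label hubA
        (λ q q≢A e → outof (gadgetArc-view hubA q e) q≢A)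
        (λ y∈ → outLeaf _ , (λ ()) , ⌊⌋≡true⁺ (_ ∈? _) y∈ , refl))
      where
      into : ∀ {q} → GadgetArc q hubA → q ≢ hubA → label q ∈ 𝔞₂ R a
      into (loopArc _) q≢A = ⊥-elim (q≢A refl)
      into (inArcA x∈) _   = x∈
      outof : ∀ {q} → GadgetArc hubA q → q ≢ hubA → label q ∈ 𝔞₃ R a
      outof (loopArc _)  q≢A = ⊥-elim (q≢A refl)
      outof (linkArc e)  _   = proj₂ (link⇒ e)
      outof (outArcA y∈) _   = y∈

    α-hubB : α R G ξ (to hubB) ≡ triple R b
    α-hubB = cong₂ (λ D U → 𝔞₁ R b , D , U)
      (image-Nin-onFinite β gadgetArc label hubB
        (λ q _ e → into (gadgetArc-view q hubB e))
        (λ x∈ → inLeaf _ , (λ ()) , ⌊⌋≡true⁺ (_ ∈? _) x∈ , refl))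
      (image-Nout-onFinite β gadgetArc label hubB
        (λ q _ e → outof (gadgetArc-view hubB q e))
        (λ y∈ → outLeaf _ , (λ ()) , ⌊⌋≡true⁺ (_ ∈? _) y∈ , refl))
      where
      into : ∀ {q} → GadgetArc q hubB → label q ∈ 𝔞₂ R b
      into (linkArc e) = proj₁ (link⇒ e)
      into (inArcB x∈) = x∈
      outof : ∀ {q} → GadgetArc hubB q → label q ∈ 𝔞₃ R b
      outof (outArcB y∈) = y∈

-- The EV-system

module EVSystem (𝔇' : Digraph → Set) (Ta⊆𝔇' : ∀ G → InTa G → 𝔇' G) (R : Digraph) where

  open EVVertex R

  EArc⇒Arc : ∀ a b → EArc 𝔇' R a b → Arc R (𝔞₁ R a) (𝔞₁ R b)
  EArc⇒Arc _ _ (_ , _ , _ , (hom , _) , v , w , vw , αv≡a , αw≡b) =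
    subst₂ (Arc R) (cong proj₁ αv≡a) (cong proj₁ αw≡b) (hom v w vw)

  EArc*⇒Linked : ∀ a b → EArc* 𝔇' R a b → Linked a b
  EArc*⇒Linked a b (a≢b , G , _ , ξ , _ , v , w , vw , αv≡a , αw≡b) =
    subst₂ _∈_ (cong proj₁ αv≡a) (cong (proj₁ ∘ proj₂) αw≡b) (∈-image⁺ ξ (∈-Nin⁺ G (v≢w , vw))) ,
    subst₂ _∈_ (cong proj₁ αw≡b) (cong (proj₂ ∘ proj₂) αv≡a) (∈-image⁺ ξ (∈-Nout⁺ G (v≢w , vw)))
    where
    v≢w : v ≢ w
    v≢w refl = a≢b (triple-injective (trans (sym αv≡a) αw≡b))

  Linked⇒EArc* : ∀ a b → Linked a b → EArc* 𝔇' R a b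
  Linked⇒EArc* a b linked =
    (λ a≡b → Linked⇒𝔞₁≢ a b linked (cong (𝔞₁ R) a≡b)) ,
    (G , Ta⊆𝔇' G G-InTa , ξ , ξ-isStrictHom , to hubA , to hubB , refl , α-hubA , α-hubB)
    where
    open Gadget R a b false true
    open Inverse β using (to)
    open Realisation (λ ()) (λ _ → linked)

  Arc⇒EArc-loop : ∀ a → Arc R (𝔞₁ R a) (𝔞₁ R a) → EArc 𝔇' R a a
  Arc⇒EArc-loop a a₁a₁ =
    G , Ta⊆𝔇' G G-InTa , ξ , ξ-isStrictHom , to hubA , to hubA , refl , α-hubA , α-hubA
    where
    open Gadget R a a true false
    open Inverse β using (to)
    open Realisation (λ _ → a₁a₁) (λ ())

  EArc? : ∀ a b → Dec (EArc 𝔇' R a b)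
  EArc? a b with a ≟EV b
  ... | yes refl = map′ (Arc⇒EArc-loop a) (EArc⇒Arc a a) (arc R (𝔞₁ R a) (𝔞₁ R a) Bool.≟ true)
  ... | no a≢b   = map′ (proj₂ ∘ Linked⇒EArc* a b) (EArc*⇒Linked a b ∘ (a≢b ,_)) (Linked? a b)

  k : ℕ
  k = proj₁ EV↔Fin

  β : EV R ↔ Fin (suc k)
  β = proj₂ EV↔Fin

  open Inverse β using (to; from; strictlyInverseʳ)

  ℰ-arc : EV R → EV R → Bool
  ℰ-arc a b = ⌊ EArc? a b ⌋

  ℰ : Digraph
  ℰ = onFinite β ℰ-arc

  ℰ-isEV : IsEV 𝔇' R ℰ β
  ℰ-isEV a b = mk⇔
    (λ e → ⌊⌋≡true⁻ (EArc? a b) (trans (sym (arc-onFinite β ℰ-arc a b)) e))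
    (λ e → trans (arc-onFinite β ℰ-arc a b) (⌊⌋≡true⁺ (EArc? a b) e))

  φ-isStrictHom : IsStrictHom ℰ R (φ R ∘ from)
  φ-isStrictHom = onFinite-isStrictHom β ℰ-arc R (𝔞₁ R)
    (λ a b e → EArc⇒Arc a b (⌊⌋≡true⁻ (EArc? a b) e))
    (λ a b a≢b e → Linked⇒𝔞₁≢ a b (EArc*⇒Linked a b (a≢b , ⌊⌋≡true⁻ (EArc? a b) e)))

  image-φ-Nin : ∀ a → image (φ R ∘ from) (Nin ℰ (to a)) ≡ 𝔞₂ R a
  image-φ-Nin a = image-Nin-onFinite β ℰ-arc (𝔞₁ R) a
    (λ c c≢a e → proj₁ (EArc*⇒Linked c a (c≢a , ⌊⌋≡true⁻ (EArc? c a) e)))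
    (λ {x} x∈ → let c = inNeighbour a x x∈
                    c≢a , c→a = Linked⇒EArc* c a (x∈ , x∈⁅x⁆ (𝔞₁ R a))
                in c , c≢a , ⌊⌋≡true⁺ (EArc? c a) c→a , refl)

  image-φ-Nout : ∀ a → image (φ R ∘ from) (Nout ℰ (to a)) ≡ 𝔞₃ R a
  image-φ-Nout a = image-Nout-onFinite β ℰ-arc (𝔞₁ R) a
    (λ c c≢a e → proj₂ (EArc*⇒Linked a c (c≢a ∘ sym , ⌊⌋≡true⁻ (EArc? a c) e)))
    (λ {y} y∈ → let c = outNeighbour a y y∈
                    a≢c , a→c = Linked⇒EArc* a c (x∈⁅x⁆ (𝔞₁ R a) , y∈)
                in c , a≢c ∘ sym , ⌊⌋≡true⁺ (EArc? a c) a→c , refl)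

  α-φ : ∀ a → α R ℰ (φ R ∘ from) (to a) ≡ triple R a
  α-φ a = cong₂ _,_ (cong (𝔞₁ R) (strictlyInverseʳ a)) (cong₂ _,_ (image-φ-Nin a) (image-φ-Nout a))

  ERD×AID : 𝔇' ℰ → ERD 𝔇' R × AID 𝔇' R
  ERD×AID ℰ∈𝔇' = (ℰ , ℰ∈𝔇' , β , ℰ-isEV) , (ℰ , ℰ∈𝔇' , β , ℰ-isEV , φ-isStrictHom , α-φ)

  ℰ-InTa : InTa R → InTa ℰ
  ℰ-InTa = strictHom-reflects-InTa ℰ R (φ R ∘ from) φ-isStrictHom

proposition3 : (𝔇' : Digraph → Set) → IsoInvariant 𝔇' → (∀ G → InTa G → 𝔇' G) →
    (R : Digraph) →
    ((a b : EV R) → EArc* 𝔇' R a b ⇔ (𝔞₁ R a ∈ 𝔞₂ R b × 𝔞₁ R b ∈ 𝔞₃ R a)) ×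
    ((a : EV R) → EArc 𝔇' R a a ⇔ Arc R (𝔞₁ R a) (𝔞₁ R a)) ×
    ((∀ G → 𝔇' G) → ERD 𝔇' R × AID 𝔇' R) ×
    (InTa R → ERD 𝔇' R × AID 𝔇' R)
proposition3 𝔇' _ Ta⊆𝔇' R =
  (λ a b → mk⇔ (EArc*⇒Linked a b) (Linked⇒EArc* a b)) ,
  (λ a → mk⇔ (EArc⇒Arc a a) (Arc⇒EArc-loop a)) ,
  (λ 𝔇'-all → ERD×AID (𝔇'-all ℰ)) ,
  (λ R-Ta → ERD×AID (Ta⊆𝔇' ℰ (ℰ-InTa R-Ta)))
  where open EVSystem 𝔇' Ta⊆𝔇' R
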